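{- A routing net is acyclic: there is no path $p$ (of positive length) in it with $s(p)=e(p)$.
   Context: A routing net is a net that is correct for the Ehrhard–Regnier correctness criterion for differential proof nets (all switching graphs acyclic) and is composed only of weakenings (0-ary $?$), coweakenings (0-ary $!$), contractions (binary $?$), cocontractions (binary $!$), and possibly floating wires, all wires being labelled by the same formula $!A$ (which fixes their orientation: each wire $w$ has a source port $s(w)$ and an end port $e(w)$). Paths: form the undirected graph whose vertices are the ports, with a wire edge between $s(w)$ and $e(w)$ for each wire $w$, and a cell edge between each auxiliary port of a cell and its principal port. A path is a finite sequence $(p_1,e_1,p_2,\dots,e_n,p_{n+1})$ of ports $p_k$ and edges $e_k$ linking $p_k$ and $p_{k+1}$ such that consecutive edges $e_k,e_{k+1}$ are of distinct nature (one wire edge, one cell edge); $s(p)=p_1$, $e(p)=p_{n+1}$. -}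

module Defs where

open import Data.Nat using (ℕ; zero; suc; _<_)
open import Data.Fin using (Fin; toℕ)
open import Data.Product using (Σ; ∃; _×_; _,_)
open import Data.Sum using (_⊎_)
open import Data.Bool using (Bool; true; false; not)
open import Data.Maybe using (Maybe; just; nothing)
open import Data.Unit using (⊤)
open import Data.List using (List; []; _∷_; length)
open import Data.List.Relation.Unary.All using (All)
open import Data.List.Relation.Unary.Linked using (Linked)
open import Data.List.Relation.Unary.Unique.Propositional using (Unique)
open import Relation.Binary.PropositionalEquality using (_≡_; _≢_)
open import Relation.Nullary using (¬_)
open import Function.Definitions using (Bijective; Injective)

data CellKind : Set where
  weakening coweakening contraction cocontraction : CellKind

arity : CellKind → ℕ
arity weakening     = 0
arity coweakening   = 0
arity contraction   = 2
arity cocontraction = 2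

isBang : CellKind → Bool
isBang weakening     = false
isBang coweakening   = true
isBang contraction   = false
isBang cocontraction = true

-- Raw nets: finitely many ports, oriented wires (all labelled !A),
-- and cells with one principal port and `arity` auxiliary ports.

record Net : Set where
  field
    nPorts nWires nCells : ℕ
    src end   : Fin nWires → Fin nPorts
    kind      : Fin nCells → CellKind
    principal : Fin nCells → Fin nPorts
    aux       : (c : Fin nCells) → Fin (arity (kind c)) → Fin nPorts

module _ (N : Net) where
  open Net N

  wireEndPort : Σ (Fin nWires) (λ _ → Bool) → Fin nPorts
  wireEndPort (w , true)  = src w
  wireEndPort (w , false) = end w

  Slot : Set
  Slot = Σ (Fin nCells) (λ c → Maybe (Fin (arity (kind c))))

  slotPort : Slot → Fin nPorts
  slotPort (c , nothing) = principal c
  slotPort (c , just i)  = aux c i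

  Oriented : Bool → Fin nPorts → Set
  Oriented true  p = ∃ λ w → src w ≡ p
  Oriented false p = ∃ λ w → end w ≡ p

  -- typing by !A: principal port of a !-cell is a wire source, its auxiliary
  -- ports are wire ends; the reverse for ?-cells.
  slotOriented : Slot → Set
  slotOriented (c , nothing) = Oriented (isBang (kind c)) (principal c)
  slotOriented (c , just i)  = Oriented (not (isBang (kind c))) (aux c i)

  data Edge : Set where
    wireE : Fin nWires → Edge
    cellE : (c : Fin nCells) → Fin (arity (kind c)) → Edge

  isWireEdge : Edge → Bool
  isWireEdge (wireE _)   = true
  isWireEdge (cellE _ _) = false

  Links : Edge → Fin nPorts → Fin nPorts → Set
  Links (wireE w)   p q = (p ≡ src w × q ≡ end w) ⊎ (p ≡ end w × q ≡ src w)
  Links (cellE c i) p q = (p ≡ aux c i × q ≡ principal c) ⊎ (p ≡ principal c × q ≡ aux c i)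

  data Walk : Fin nPorts → Fin nPorts → Set where
    nil  : ∀ {p} → Walk p p
    cons : ∀ {p q r} (e : Edge) → Links e p q → Walk q r → Walk p r

  walkEdges : ∀ {p q} → Walk p q → List Edge
  walkEdges nil          = []
  walkEdges (cons e _ w) = e ∷ walkEdges w

  -- p_1, ..., p_n (all ports visited except the last one)
  walkPorts : ∀ {p q} → Walk p q → List (Fin nPorts)
  walkPorts nil                  = []
  walkPorts (cons {p = p} _ _ w) = p ∷ walkPorts w

  record Path (p q : Fin nPorts) : Set where
    field
      walk        : Walk p q
      alternating : Linked (λ e e′ → isWireEdge e ≢ isWireEdge e′) (walkEdges walk)

  pathLength : ∀ {p q} → Path p q → ℕ
  pathLength π = length (walkEdges (Path.walk π))

  -- Switchings: for each binary cell (contraction or cocontraction),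
  -- keep exactly one of the two auxiliary cell edges.

  Switching : Set
  Switching = Fin nCells → Fin 2

  InSwitching : Switching → Edge → Set
  InSwitching S (wireE _)   = ⊤
  InSwitching S (cellE c i) = toℕ i ≡ toℕ (S c)

  record SwitchingCycle (S : Switching) : Set where
    field
      base     : Fin nPorts
      walk     : Walk base base
      inGraph  : All (InSwitching S) (walkEdges walk)
      positive : 0 < length (walkEdges walk)
      edgesDistinct : Unique (walkEdges walk)
      portsDistinct : Unique (walkPorts walk)

  Correct : Set
  Correct = ∀ (S : Switching) → ¬ SwitchingCycle S

  record WellFormed : Set where
    field
      wiresPartition : Bijective _≡_ _≡_ wireEndPort
      cellsDisjoint  : Injective _≡_ _≡_ slotPort
      oriented       : ∀ (s : Slot) → slotOriented s

  record RoutingNet : Set where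
    field
      wellFormed : WellFormed
      correct    : Correct

{-# OPTIONS --safe #-}
module Submission where

-- Every port is the source or the end of exactly one wire, and the typing by !A makes every
-- edge, wire or cell edge, join a source port to an end port.  Orient wires from source to
-- end and cell edges from the port ending a wire to the port starting one (for a contraction:
-- from principal to auxiliary port).  Along an alternating path the edges are then either all
-- traversed forwards or all backwards, so a closed alternating path gives, after possibly
-- reversing it, a closed forward walk, and by loop erasure a simple forward cycle.  A forward
-- walk enters a contraction and leaves a cocontraction through its principal port, so a simple
-- forward cycle uses at most one auxiliary edge of each cell: it lies in a single switching
-- graph, against correctness.

open import Defs
open import Data.Bool using (Bool; true; false; not; if_then_else_)
open import Data.Bool.Properties using (not-involutive; not-injective; ¬-not)
import Data.Bool.Properties as Bool
open import Data.Fin using (Fin; zero; toℕ; inject≤)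
open import Data.Fin.Properties using (_≟_; toℕ-inject≤)
open import Data.List using (List; []; _∷_; _∷ʳ_; length; map)
open import Data.List.Membership.Propositional using (_∈_)
open import Data.List.Membership.Propositional.Properties using (∈-map⁺)
open import Data.List.Relation.Binary.Subset.Propositional using (_⊆_)
open import Data.List.Relation.Binary.Subset.Propositional.Properties using (∷⁺ʳ)
open import Data.List.Relation.Unary.All using (All; [])
import Data.List.Relation.Unary.All as All
open import Data.List.Relation.Unary.All.Properties using (¬Any⇒All¬; anti-mono)
open import Data.List.Relation.Unary.Any using (here; there)
open import Data.List.Relation.Unary.AllPairs using ([]; _∷_)
open import Data.List.Relation.Unary.Linked using (Linked; []; _∷_)
open import Data.List.Relation.Unary.Unique.Propositional using (Unique)
open import Data.List.Relation.Unary.Unique.Propositional.Properties using (map⁻)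
open import Data.Maybe using (just; nothing)
open import Data.Nat using (_≤_; _<_; z≤n; s≤s)
open import Data.Nat.Properties using (≤-refl)
open import Data.Product using (Σ; ∃; _×_; _,_; proj₁; proj₂; uncurry)
import Data.Product as Product
open import Data.Sum using (_⊎_; inj₁; inj₂)
open import Data.Unit using (tt)
open import Function using (_∘_; _⇔_; mk⇔; Equivalence)
open import Relation.Binary.PropositionalEquality
  using (_≡_; _≢_; refl; sym; trans; cong; subst; setoid)
open import Relation.Nullary using (¬_; yes; no; contradiction)

Unique-map⇒injectiveOn : ∀ {A B : Set} (f : A → B) {xs : List A} {x y : A} →
  Unique (map f xs) → x ∈ xs → y ∈ xs → f x ≡ f y → x ≡ y
Unique-map⇒injectiveOn f _ (here refl) (here refl) _ = refl
Unique-map⇒injectiveOn f (fx∉ ∷ _) (here refl) (there y∈) fx≡fy =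
  contradiction fx≡fy (All.lookup fx∉ (∈-map⁺ f y∈))
Unique-map⇒injectiveOn f (fy∉ ∷ _) (there x∈) (here refl) fx≡fy =
  contradiction (sym fx≡fy) (All.lookup fy∉ (∈-map⁺ f x∈))
Unique-map⇒injectiveOn f (_ ∷ u) (there x∈) (there y∈) fx≡fy =
  Unique-map⇒injectiveOn f u x∈ y∈ fx≡fy

arity≤2 : ∀ k → arity k ≤ 2
arity≤2 weakening     = z≤n
arity≤2 coweakening   = z≤n
arity≤2 contraction   = ≤-refl
arity≤2 cocontraction = ≤-refl

module _ (N : Net) where
  open Net N

  Port : Set
  Port = Fin nPorts

  private variable
    p q r x y : Port

  open import Data.List.Relation.Binary.Permutation.Setoid (setoid Port)
    using (_↭_; ↭-refl; ↭-trans; ↭-sym; ↭-reflexive)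
  open import Data.List.Relation.Binary.Permutation.Setoid.Properties (setoid Port)
    using (∷↭∷ʳ; Unique-resp-↭)
  open import Data.List.Membership.DecPropositional (_≟_ {nPorts}) using (_∈?_)

  Links-sym : ∀ e → Links N e p q → Links N e q p
  Links-sym (wireE _)   (inj₁ (p≡ , q≡)) = inj₂ (q≡ , p≡)
  Links-sym (wireE _)   (inj₂ (p≡ , q≡)) = inj₁ (q≡ , p≡)
  Links-sym (cellE _ _) (inj₁ (p≡ , q≡)) = inj₂ (q≡ , p≡)
  Links-sym (cellE _ _) (inj₂ (p≡ , q≡)) = inj₁ (q≡ , p≡)

  cellE-injective : ∀ {c} {i j : Fin (arity (kind c))} → cellE {N} c i ≡ cellE c j → i ≡ j
  cellE-injective refl = refl

  data AllSteps (P : Edge N → Port → Set) : Walk N p q → Set where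
    []  : AllSteps P (nil {N} {p})
    _∷_ : ∀ {e} {l : Links N e p q} {w : Walk N q r} →
          P e p → AllSteps P w → AllSteps P (cons e l w)

  source target : Edge N → Port
  source (wireE w)   = src w
  source (cellE c i) = if isBang (kind c) then aux c i else principal c
  target (wireE w)   = end w
  target (cellE c i) = if isBang (kind c) then principal c else aux c i

  principal-is-source⊎target : ∀ c → (∀ i → source (cellE c i) ≡ principal c)
                                   ⊎ (∀ i → target (cellE c i) ≡ principal c)
  principal-is-source⊎target c with isBang (kind c)
  ... | false = inj₁ λ _ → refl
  ... | true  = inj₂ λ _ → refl

  switchingFor : List (Edge N) → Switching N
  switchingFor []                 c = zero
  switchingFor (wireE _ ∷ es)     c = switchingFor es c
  switchingFor (cellE c′ i ∷ es) c with c′ ≟ c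
  ... | yes refl = inject≤ i (arity≤2 (kind c′))
  ... | no _     = switchingFor es c

  switchingFor-selects : ∀ es {c i} → cellE c i ∈ es →
    ∃ λ j → cellE c j ∈ es × toℕ (switchingFor es c) ≡ toℕ j
  switchingFor-selects (wireE _ ∷ es) (there i∈) =
    Product.map₂ (Product.map₁ there) (switchingFor-selects es i∈)
  switchingFor-selects (cellE c′ i′ ∷ es) {c} i∈ with c′ ≟ c | i∈
  ... | yes refl | _         = i′ , here refl , toℕ-inject≤ i′ _
  ... | no c′≢c  | here refl = contradiction refl c′≢c
  ... | no _     | there i∈′ =
    Product.map₂ (Product.map₁ there) (switchingFor-selects es i∈′)

  switchingFor-contains : (es : List (Edge N)) →
    (∀ {c i j} → cellE c i ∈ es → cellE c j ∈ es → i ≡ j) →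
    All (InSwitching N (switchingFor es)) es
  switchingFor-contains es onePerCell = All.tabulate contained
    where
    contained : ∀ {e} → e ∈ es → InSwitching N (switchingFor es) e
    contained {wireE _}   _  = tt
    contained {cellE c i} i∈ =
      let j , j∈ , chosen = switchingFor-selects es i∈
      in  trans (cong toℕ (onePerCell i∈ j∈)) (sym chosen)

  module Orientation (wf : WellFormed N) where
    open WellFormed wf

    isSource : Port → Bool
    isSource p = proj₂ (proj₁ (proj₂ wiresPartition p))

    isSource-wireEndPort : ∀ x → isSource (wireEndPort N x) ≡ proj₂ x
    isSource-wireEndPort x with proj₂ wiresPartition (wireEndPort N x)
    ... | _ , onto = cong proj₂ (proj₁ wiresPartition (onto refl))

    isSource-src : ∀ w → isSource (src w) ≡ true
    isSource-src w = isSource-wireEndPort (w , true)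

    isSource-end : ∀ w → isSource (end w) ≡ false
    isSource-end w = isSource-wireEndPort (w , false)

    isSource-oriented : ∀ b → Oriented N b p → isSource p ≡ b
    isSource-oriented true  (w , refl) = isSource-src w
    isSource-oriented false (w , refl) = isSource-end w

    isSource-principal : ∀ c → isSource (principal c) ≡ isBang (kind c)
    isSource-principal c = isSource-oriented _ (oriented (c , nothing))

    isSource-aux : ∀ c i → isSource (aux c i) ≡ not (isBang (kind c))
    isSource-aux c i = isSource-oriented _ (oriented (c , just i))

    isSource-flips : ∀ e → Links N e p q → isSource q ≡ not (isSource p)
    isSource-flips (wireE w) (inj₁ (refl , refl))
      rewrite isSource-src w | isSource-end w = refl
    isSource-flips (wireE w) (inj₂ (refl , refl))
      rewrite isSource-src w | isSource-end w = refl
    isSource-flips (cellE c i) (inj₁ (refl , refl))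
      rewrite isSource-principal c | isSource-aux c i = sym (not-involutive _)
    isSource-flips (cellE c i) (inj₂ (refl , refl))
      rewrite isSource-principal c | isSource-aux c i = refl

    Forward : Edge N → Port → Set
    Forward e p = isSource p ≡ isWireEdge N e

    Backward : Edge N → Port → Set
    Backward e p = ¬ Forward e p

    Forward-preserved : ∀ e {e′} → Links N e p q → isWireEdge N e ≢ isWireEdge N e′ →
                        Forward e p ⇔ Forward e′ q
    Forward-preserved e l alt
      rewrite isSource-flips e l | ¬-not (alt ∘ sym) = mk⇔ (cong not) not-injective

    Backward⇒reverse-Forward : ∀ e → Links N e p q → Backward e p → Forward e q
    Backward⇒reverse-Forward e l bwd = trans (isSource-flips e l) (sym (¬-not (bwd ∘ sym)))

    forward-endpoints : ∀ e → Links N e p q → Forward e p → p ≡ source e × q ≡ target e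
    forward-endpoints (wireE w) (inj₁ (refl , refl)) _ = refl , refl
    forward-endpoints (wireE w) (inj₂ (refl , refl)) fwd =
      contradiction (trans (sym (isSource-end w)) fwd) λ ()
    forward-endpoints (cellE c i) (inj₁ (refl , refl)) fwd
      with isBang (kind c) | isSource-aux c i
    ... | true  | _     = refl , refl
    ... | false | isSrc = contradiction (trans (sym isSrc) fwd) λ ()
    forward-endpoints (cellE c i) (inj₂ (refl , refl)) fwd
      with isBang (kind c) | isSource-principal c
    ... | false | _     = refl , refl
    ... | true  | isSrc = contradiction (trans (sym isSrc) fwd) λ ()

    alternating⇒Forward⊎Backward : (w : Walk N p q) →
      Linked (λ e e′ → isWireEdge N e ≢ isWireEdge N e′) (walkEdges N w) →
      AllSteps Forward w ⊎ AllSteps Backward w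
    alternating⇒Forward⊎Backward nil _ = inj₁ []
    alternating⇒Forward⊎Backward {p} (cons e l nil) _ with isSource p Bool.≟ isWireEdge N e
    ... | yes fwd = inj₁ (fwd ∷ [])
    ... | no bwd  = inj₂ (bwd ∷ [])
    alternating⇒Forward⊎Backward (cons e l w@(cons _ _ _)) (alt ∷ alts)
      with alternating⇒Forward⊎Backward w alts
    ... | inj₁ fwds@(fwd ∷ _) = inj₁ (Equivalence.from (Forward-preserved e l alt) fwd ∷ fwds)
    ... | inj₂ bwds@(bwd ∷ _) = inj₂ (bwd ∘ Equivalence.to (Forward-preserved e l alt) ∷ bwds)

    data ForwardWalk : Port → Port → Set where
      []   : ForwardWalk p p
      step : ∀ e → Links N e p q → Forward e p → ForwardWalk q r → ForwardWalk p r

    toWalk : ForwardWalk p q → Walk N p q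
    toWalk []             = nil
    toWalk (step e l _ w) = cons e l (toWalk w)

    edges : ForwardWalk p q → List (Edge N)
    edges = walkEdges N ∘ toWalk

    ports : ForwardWalk p q → List Port
    ports = walkPorts N ∘ toWalk

    vertices : ForwardWalk p q → List Port
    vertices {q = q} w = ports w ∷ʳ q

    ports≡map-source : (w : ForwardWalk p q) → ports w ≡ map source (edges w)
    ports≡map-source []               = refl
    ports≡map-source (step e l fwd w) with forward-endpoints e l fwd
    ... | refl , _ = cong (source e ∷_) (ports≡map-source w)

    ∷map-target≡vertices : (w : ForwardWalk p q) → p ∷ map target (edges w) ≡ vertices w
    ∷map-target≡vertices []               = refl
    ∷map-target≡vertices (step e l fwd w) with forward-endpoints e l fwd
    ... | refl , refl = cong (source e ∷_) (∷map-target≡vertices w)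

    map-target↭ports : (w : ForwardWalk p p) → map target (edges w) ↭ ports w
    map-target↭ports []               = ↭-refl
    map-target↭ports (step e l fwd w) with forward-endpoints e l fwd
    ... | refl , refl =
      ↭-trans (↭-reflexive (∷map-target≡vertices w)) (↭-sym (∷↭∷ʳ (source e) (ports w)))

    forwardWalk : (w : Walk N p q) → AllSteps Forward w → ForwardWalk p q
    forwardWalk nil          []           = []
    forwardWalk (cons e l w) (fwd ∷ fwds) = step e l fwd (forwardWalk w fwds)

    reverseOnto : (w : Walk N p q) → AllSteps Backward w → ForwardWalk p r → ForwardWalk q r
    reverseOnto nil          []           acc = acc
    reverseOnto (cons e l w) (bwd ∷ bwds) acc =
      reverseOnto w bwds (step e (Links-sym e l) (Backward⇒reverse-Forward e l bwd) acc)

    reverseOnto-positive : (w : Walk N p q) (bwds : AllSteps Backward w) (acc : ForwardWalk p r) →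
      0 < length (edges acc) → 0 < length (edges (reverseOnto w bwds acc))
    reverseOnto-positive nil          []           acc pos = pos
    reverseOnto-positive (cons e l w) (bwd ∷ bwds) acc _   =
      reverseOnto-positive w bwds _ (s≤s z≤n)

    record ForwardCycle : Set where
      field
        base     : Port
        walk     : ForwardWalk base base
        positive : 0 < length (edges walk)

    IsSimple : ForwardCycle → Set
    IsSimple c = Unique (ports (ForwardCycle.walk c))

    closedPath⇒ForwardCycle : (π : Path N p p) → 0 < pathLength N π → ForwardCycle
    closedPath⇒ForwardCycle record { walk = nil } ()
    closedPath⇒ForwardCycle {p} record { walk = cons e l w ; alternating = alt } _
      with alternating⇒Forward⊎Backward (cons e l w) alt
    ... | inj₁ (fwd ∷ fwds) = record
      { base = p ; walk = step e l fwd (forwardWalk w fwds) ; positive = s≤s z≤n }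
    ... | inj₂ (bwd ∷ bwds) = record
      { base     = p
      ; walk     = reverseOnto (cons e l w) (bwd ∷ bwds) []
      ; positive = reverseOnto-positive w bwds _ (s≤s z≤n)
      }

    closeSimpleWalk : ∀ e → Links N e p q → Forward e p →
                      (w : ForwardWalk q p) → Unique (vertices w) → Σ ForwardCycle IsSimple
    closeSimpleWalk {p} e l fwd w distinct =
      record { base = p ; walk = step e l fwd w ; positive = s≤s z≤n }
      , Unique-resp-↭ (↭-sym (∷↭∷ʳ p (ports w))) distinct

    prefixTo : (w : ForwardWalk y q) → x ∈ vertices w → Unique (vertices w) →
               Σ (ForwardWalk y x) λ w₁ → Unique (vertices w₁) × vertices w₁ ⊆ vertices w
    prefixTo []               (here refl) distinct = [] , distinct , λ x∈ → x∈
    prefixTo (step e l fwd w) (here refl) _        = [] , [] ∷ [] , ∷⁺ʳ _ λ ()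
    prefixTo (step e l fwd w) (there x∈) (y∉ ∷ distinct) with prefixTo w x∈ distinct
    ... | w₁ , distinct₁ , w₁⊆w =
      step e l fwd w₁ , anti-mono w₁⊆w y∉ ∷ distinct₁ , ∷⁺ʳ _ w₁⊆w

    loopErase : (w : ForwardWalk p q) →
                Σ ForwardCycle IsSimple ⊎ Σ (ForwardWalk p q) (Unique ∘ vertices)
    loopErase [] = inj₂ ([] , [] ∷ [])
    loopErase {p} (step e l fwd w) with loopErase w
    ... | inj₁ cycle = inj₁ cycle
    ... | inj₂ (w′ , distinct) with p ∈? vertices w′
    ...   | no p∉  = inj₂ (step e l fwd w′ , ¬Any⇒All¬ _ p∉ ∷ distinct)
    ...   | yes p∈ = let w₁ , distinct₁ , _ = prefixTo w′ p∈ distinct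
                     in inj₁ (closeSimpleWalk e l fwd w₁ distinct₁)

    simpleForwardCycle : ForwardCycle → Σ ForwardCycle IsSimple
    simpleForwardCycle record { walk = [] ; positive = () }
    simpleForwardCycle record { walk = step e l fwd w } with loopErase w
    ... | inj₁ cycle           = cycle
    ... | inj₂ (w′ , distinct) = closeSimpleWalk e l fwd w′ distinct

    simpleCycle-auxUnique : (w : ForwardWalk p p) → Unique (ports w) →
      ∀ {c i j} → cellE c i ∈ edges w → cellE c j ∈ edges w → i ≡ j
    simpleCycle-auxUnique w distinct {c} i∈ j∈ with principal-is-source⊎target c
    ... | inj₁ sources = cellE-injective
      (Unique-map⇒injectiveOn source (subst Unique (ports≡map-source w) distinct)
        i∈ j∈ (trans (sources _) (sym (sources _))))
    ... | inj₂ targets = cellE-injective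
      (Unique-map⇒injectiveOn target (Unique-resp-↭ (↭-sym (map-target↭ports w)) distinct)
        i∈ j∈ (trans (targets _) (sym (targets _))))

    switchingCycle : Σ ForwardCycle IsSimple → ∃ (SwitchingCycle N)
    switchingCycle (record { base = b ; walk = w ; positive = pos } , distinct) =
      switchingFor (edges w) , record
        { base          = b
        ; walk          = toWalk w
        ; inGraph       = switchingFor-contains (edges w) (simpleCycle-auxUnique w distinct)
        ; positive      = pos
        ; edgesDistinct = map⁻ (subst Unique (ports≡map-source w) distinct)
        ; portsDistinct = distinct
        }

mainTheorem10 : (N : Net) → RoutingNet N → (p : Fin (Net.nPorts N)) → (π : Path N p p) → ¬ (0 < pathLength N π)
mainTheorem10 N rn p π pos =
  uncurry correct (switchingCycle (simpleForwardCycle (closedPath⇒ForwardCycle π pos)))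
  where
  open RoutingNet rn
  open Orientation N wellFormed
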